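{- Let $G$ be a tree or a connected graph with girth $g(G)\ge 7$, having $n$ vertices, $m$ edges and diameter $d$. Let $M_1,M_2$ be the first and second Zagreb indices of $G$, and let $0<\alpha<1$. Put \[ L=\alpha^{d}\bigl(n(n-1)+M_1-2m-2M_2\bigr)+2\alpha^{3}(M_2+m)+\alpha^{2}M_1(1-2\alpha)+2m\alpha(1-\alpha), \] \[ U=\alpha^{4}\bigl(n(n-1)+M_1-2m-2M_2\bigr)+2\alpha^{3}(M_2+m)+\alpha^{2}M_1(1-2\alpha)+2m\alpha(1-\alpha). \] Then $L\le GC(G)\le U$, and \[ \frac{n(n-1)+M_1-2m-2M_2}{2^{d}}+\frac{M_2+3m}{4}\;\le\; C(G)\;\le\;\frac{n(n-1)+M_1+2M_2+10m}{16}. \] In each formula, equality holds (in both inequalities) if the diameter $d$ is at most $4$.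
   Context: All graphs are finite and simple. The girth $g(G)$ is the length of a shortest cycle in $G$. For vertices $i,j$ of a connected graph $G$, $d(i,j)$ is their distance; the diameter is $\max_{i,j}d(i,j)$. With $d_v$ the degree of $v$, the first Zagreb index is $M_1(G)=\sum_{v\in V(G)}d_v^2$ and the second Zagreb index is $M_2(G)=\sum_{uv\in E(G)}d_ud_v$. The closeness is $C(G)=\sum_{i\in V(G)}\sum_{j\neq i}2^{ -d(i,j)}$, and for fixed $0<\alpha<1$ the generalized closeness is $GC(G)=\sum_{i\in V(G)}\sum_{j\neq i}\alpha^{d(i,j)}$.
   Formalization: The parameter α ranges over the rationals with $0<\alpha<1$ rather than over the real numbers. -}

module Defs where

open import Data.Bool using (Bool; true; false; if_then_else_; _∧_)
open import Data.Nat as ℕ using (ℕ; zero; suc; _<ᵇ_)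
open import Data.Fin as Fin using (Fin; toℕ; inject₁)
open import Data.Fin.Properties using () renaming (_≟_ to _≟ᶠ_)
open import Data.Integer using (+_)
open import Data.List using (List; []; _∷_; allFin; map; filter; concatMap; length; foldr)
open import Data.Product using (Σ; ∃; _×_; _,_)
open import Data.Rational as ℚ using (ℚ; 0ℚ; 1ℚ; ½; _/_)
open import Function.Definitions using (Injective)
open import Relation.Binary.PropositionalEquality using (_≡_)
open import Relation.Nullary using (¬_; does)

record Graph (n : ℕ) : Set where
  field
    adj    : Fin n → Fin n → Bool
    sym    : ∀ i j → adj i j ≡ adj j i
    irrefl : ∀ i → adj i i ≡ false
open Graph public

module _ {n : ℕ} (G : Graph n) where

  Adj : Fin n → Fin n → Set
  Adj i j = adj G i j ≡ true

  data Walk : Fin n → Fin n → ℕ → Set where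
    nil  : ∀ {i} → Walk i i 0
    cons : ∀ {i j k l} → Adj i j → Walk j k l → Walk i k (suc l)

  Connected : Set
  Connected = ∀ i j → ∃ λ l → Walk i j l

  IsDistance : (Fin n → Fin n → ℕ) → Set
  IsDistance dist = ∀ i j → Walk i j (dist i j) × (∀ l → Walk i j l → dist i j ℕ.≤ l)

  IsDiameter : (Fin n → Fin n → ℕ) → ℕ → Set
  IsDiameter dist D = (∀ i j → dist i j ℕ.≤ D) × (∃ λ i → ∃ λ j → dist i j ≡ D)

  HasCycle : ℕ → Set
  HasCycle zero = Data.Empty.⊥ where import Data.Empty
  HasCycle (suc k') =
    (3 ℕ.≤ suc k') ×
    (Σ (Fin (suc k') → Fin n) λ v →
       Injective _≡_ _≡_ v ×
       (∀ (t : Fin k') → Adj (v (inject₁ t)) (v (Fin.suc t))) ×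
       Adj (v (Fin.fromℕ k')) (v Fin.zero))

  Acyclic : Set
  Acyclic = ∀ k → ¬ HasCycle k

  IsTree : Set
  IsTree = Connected × Acyclic

  -- girth(G) ≥ g  (vacuous for acyclic graphs, whose girth is ∞)
  GirthAtLeast : ℕ → Set
  GirthAtLeast g = ∀ k → HasCycle k → g ℕ.≤ k

  degree : Fin n → ℕ
  degree i = length (filter (λ j → adj G i j ≡? true) (allFin n))
    where
    open import Data.Bool.Properties using () renaming (_≟_ to _≡?_)

  edges : List (Fin n × Fin n)
  edges = concatMap (λ i → map (λ j → (i , j))
            (filter (λ j → (adj G i j ∧ (toℕ i <ᵇ toℕ j)) ≡? true) (allFin n)))
            (allFin n)
    where
    open import Data.Bool.Properties using () renaming (_≟_ to _≡?_)

  numEdges : ℕ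
  numEdges = length edges

  sumℕ : List ℕ → ℕ
  sumℕ = foldr ℕ._+_ 0

  M₁ : ℕ
  M₁ = sumℕ (map (λ i → degree i ℕ.* degree i) (allFin n))

  M₂ : ℕ
  M₂ = sumℕ (map (λ { (u , v) → degree u ℕ.* degree v }) edges)

infixr 8 _^ℚ_
_^ℚ_ : ℚ → ℕ → ℚ
q ^ℚ zero  = 1ℚ
q ^ℚ suc k = q ℚ.* (q ^ℚ k)

fromℕ : ℕ → ℚ
fromℕ k = + k / 1

sumℚ : List ℚ → ℚ
sumℚ = foldr ℚ._+_ 0ℚ

pairSum : ∀ {n} → (Fin n → Fin n → ℕ) → (ℕ → ℚ) → ℚ
pairSum {n} dist f =
  sumℚ (map (λ i → sumℚ (map (λ j → f (dist i j))
     (filter (λ j → ¬? (i ≟ᶠ j)) (allFin n)))) (allFin n))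
  where open import Relation.Nullary using (¬?)

GC : ∀ {n} → (Fin n → Fin n → ℕ) → ℚ → ℚ
GC dist α = pairSum dist (λ k → α ^ℚ k)

closeness : ∀ {n} → (Fin n → Fin n → ℕ) → ℚ
closeness dist = pairSum dist (λ k → ½ ^ℚ k)

module Submission where

-- If G has no cycle of length at most 6, then for i ≠ j there is exactly one edge, one common
-- neighbour, or one path i a b j (with b ≠ i, a ≠ j) from i to j when d(i,j) is 1, 2 or 3
-- respectively, and none otherwise: a second such path, or one shorter than d(i,j), would close
-- a cycle of length at most 6. Counting these paths over ordered pairs gives 2m, M₁ − 2m and
-- 2M₂ − 2M₁ + 2m pairs at distance 1, 2 and 3, so the remaining R = n(n−1) + M₁ − 2m − 2M₂
-- ordered pairs are at distance between 4 and d, where α^d ≤ α^d(i,j) ≤ α^4, with equality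
-- throughout when d ≤ 4. The closeness is the case α = ½.

open import Defs hiding (sym)
open import Data.Nat using (ℕ)
import Data.Nat
open import Data.Fin using (Fin)
open import Data.Product using (_×_)
open import Data.Sum using (_⊎_)
open import Data.Rational using (ℚ; 0ℚ; 1ℚ; _+_; _-_; _*_; _/_; _≤_; _<_; ½)
open import Data.Integer using (+_)
open import Relation.Binary.PropositionalEquality using (_≡_)

open import Algebra.Bundles using (CommutativeRing)
open import Data.Bool using (true; false; _∧_)
open import Data.Bool.Properties using () renaming (_≟_ to _≟ᵇ_)
open import Data.Empty using (⊥; ⊥-elim)
open import Data.Fin using (zero; suc; toℕ; inject₁) renaming (_≟_ to _≟ᶠ_; fromℕ to fromℕᶠ)
import Data.Fin.Properties as Fin
import Data.Integer as ℤ
import Data.Integer.Properties as ℤ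
open import Data.List as List using (List; []; _∷_; map; filter; concatMap; length; allFin; tabulate; _++_)
import Data.List.Properties as List
open import Data.Nat as ℕ using (zero; suc; _<ᵇ_; z≤n; s≤s)
import Data.Nat.Coprimality as Coprimality
import Data.Nat.ListAction as ℕ
import Data.Nat.Properties as ℕ
open import Data.Product using (_,_; ∃; ∃₂; proj₁; proj₂; uncurry)
open import Data.Rational using (mkℚ; nonNegative)
open import Data.Rational.Properties
open import Data.Sum using (inj₁; inj₂)
open import Data.Vec using (Vec; []; _∷_; lookup)
open import Data.Vec.Relation.Unary.All using ([]; _∷_)
open import Data.Vec.Relation.Unary.AllPairs using ([]; _∷_)
open import Data.Vec.Relation.Unary.Linked using (Linked; []; [-]; _∷_)
open import Data.Vec.Relation.Unary.Unique.Propositional using (Unique)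
open import Data.Vec.Relation.Unary.Unique.Propositional.Properties using (lookup-injective)
open import Function using (_∘_)
open import Level using (Level; 0ℓ)
open import Relation.Binary.PropositionalEquality
  using (refl; sym; trans; cong; cong₂; subst; _≢_; ≢-sym; module ≡-Reasoning)
open import Relation.Nullary using (Dec; yes; no; _because_; ¬_; ¬?; contradiction)
open import Relation.Nullary.Decidable using (_×-dec_; toWitness)
import Relation.Nullary.Decidable.Core as Dec
open import Relation.Unary using (Decidable)
open import Tactic.RingSolver using (solve-∀)
open import Tactic.RingSolver.Core.AlmostCommutativeRing using (AlmostCommutativeRing; fromCommutativeRing)

ℚ-ring : AlmostCommutativeRing 0ℓ 0ℓ
ℚ-ring = fromCommutativeRing +-*-commutativeRing (λ x → Dec.dec⇒maybe (0ℚ ≟ x))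

fromℕ-suc : ∀ k → fromℕ (suc k) ≡ 1ℚ + fromℕ k
fromℕ-suc k = begin
  + suc k / 1                     ≡⟨ cong (λ z → (+ 1 ℤ.+ z) / 1) (ℤ.*-identityʳ (+ k)) ⟨
  1ℚ + mkℚ (+ k) 0 k/1-coprime    ≡⟨ cong (λ z → 1ℚ + z) (↥p/↧p≡p (mkℚ (+ k) 0 k/1-coprime)) ⟨
  1ℚ + fromℕ k                    ∎
  where
  open ≡-Reasoning
  k/1-coprime = Coprimality.sym (Coprimality.1-coprimeTo k)

fromℕ-+ : ∀ k l → fromℕ (k ℕ.+ l) ≡ fromℕ k + fromℕ l
fromℕ-+ zero    l = sym (+-identityˡ (fromℕ l))
fromℕ-+ (suc k) l = begin
  fromℕ (suc (k ℕ.+ l))         ≡⟨ fromℕ-suc (k ℕ.+ l) ⟩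
  1ℚ + fromℕ (k ℕ.+ l)          ≡⟨ cong (λ z → 1ℚ + z) (fromℕ-+ k l) ⟩
  1ℚ + (fromℕ k + fromℕ l)      ≡⟨ +-assoc 1ℚ (fromℕ k) (fromℕ l) ⟨
  (1ℚ + fromℕ k) + fromℕ l      ≡⟨ cong (_+ fromℕ l) (fromℕ-suc k) ⟨
  fromℕ (suc k) + fromℕ l       ∎
  where open ≡-Reasoning

fromℕ-* : ∀ k l → fromℕ (k ℕ.* l) ≡ fromℕ k * fromℕ l
fromℕ-* zero    l = sym (*-zeroˡ (fromℕ l))
fromℕ-* (suc k) l = begin
  fromℕ (l ℕ.+ k ℕ.* l)         ≡⟨ fromℕ-+ l (k ℕ.* l) ⟩
  fromℕ l + fromℕ (k ℕ.* l)     ≡⟨ cong (λ z → fromℕ l + z) (fromℕ-* k l) ⟩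
  fromℕ l + fromℕ k * fromℕ l   ≡⟨ distrib (fromℕ k) (fromℕ l) ⟩
  (1ℚ + fromℕ k) * fromℕ l      ≡⟨ cong (_* fromℕ l) (fromℕ-suc k) ⟨
  fromℕ (suc k) * fromℕ l       ∎
  where
  open ≡-Reasoning
  distrib : ∀ x y → y + x * y ≡ (1ℚ + x) * y
  distrib = solve-∀ ℚ-ring

private
  variable
    ℓ : Level
    P Q : Set ℓ

𝟙 : Dec P → ℚ
𝟙 (true  because _) = 1ℚ
𝟙 (false because _) = 0ℚ

𝟙-yes : (P? : Dec P) → P → 𝟙 P? ≡ 1ℚ
𝟙-yes (yes _) _ = refl
𝟙-yes (no ¬p) p = contradiction p ¬p

𝟙-no : (P? : Dec P) → ¬ P → 𝟙 P? ≡ 0ℚ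
𝟙-no (yes p) ¬p = contradiction p ¬p
𝟙-no (no _)  _  = refl

𝟙-¬ : (P? : Dec P) → 𝟙 (¬? P?) ≡ 1ℚ - 𝟙 P?
𝟙-¬ (yes _) = refl
𝟙-¬ (no _)  = refl

𝟙-idem : (P? : Dec P) → 𝟙 P? * 𝟙 P? ≡ 𝟙 P?
𝟙-idem (yes _) = refl
𝟙-idem (no _)  = refl

𝟙-absorb : (P? : Dec P) (x y : ℚ) → 𝟙 P? * ((x - 𝟙 P?) * (y - 𝟙 P?)) ≡ 𝟙 P? * ((x - 1ℚ) * (y - 1ℚ))
𝟙-absorb (yes _) x y = refl
𝟙-absorb (no _)  x y = trans (*-zeroˡ ((x - 0ℚ) * (y - 0ℚ))) (sym (*-zeroˡ ((x - 1ℚ) * (y - 1ℚ))))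

𝟙-× : (P? : Dec P) (Q? : Dec Q) → 𝟙 (P? ×-dec Q?) ≡ 𝟙 P? * 𝟙 Q?
𝟙-× (yes _) (yes _) = refl
𝟙-× (yes _) (no _)  = refl
𝟙-× (no _)  (yes _) = refl
𝟙-× (no _)  (no _)  = refl

𝟙-⇔ : (P? : Dec P) (Q? : Dec Q) → (P → Q) → (Q → P) → 𝟙 P? ≡ 𝟙 Q?
𝟙-⇔ P? (yes q) _   Q→P = 𝟙-yes P? (Q→P q)
𝟙-⇔ P? (no ¬q) P→Q _   = 𝟙-no P? (¬q ∘ P→Q)

module _ {α : ℚ} (0≤α : 0ℚ ≤ α) where

  ^ℚ-nonNeg : ∀ k → 0ℚ ≤ α ^ℚ k
  ^ℚ-nonNeg zero    = nonNegative⁻¹ 1ℚ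
  ^ℚ-nonNeg (suc k) = nonNegative⁻¹ (α * α ^ℚ k)
    {{nonNeg*nonNeg⇒nonNeg α {{nonNegative 0≤α}} (α ^ℚ k) {{nonNegative (^ℚ-nonNeg k)}}}}

  ^ℚ-antitone : α ≤ 1ℚ → ∀ {j k} → j ℕ.≤ k → α ^ℚ k ≤ α ^ℚ j
  ^ℚ-antitone α≤1 {k = zero}  z≤n = ≤-refl
  ^ℚ-antitone α≤1 {k = suc k} z≤n = begin
    α * α ^ℚ k    ≤⟨ *-monoʳ-≤-nonNeg (α ^ℚ k) {{nonNegative (^ℚ-nonNeg k)}} α≤1 ⟩
    1ℚ * α ^ℚ k   ≡⟨ *-identityˡ (α ^ℚ k) ⟩
    α ^ℚ k        ≤⟨ ^ℚ-antitone α≤1 {k = k} z≤n ⟩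
    1ℚ            ∎
    where open ≤-Reasoning
  ^ℚ-antitone α≤1 (s≤s j≤k) = *-monoˡ-≤-nonNeg α {{nonNegative 0≤α}} (^ℚ-antitone α≤1 j≤k)

  beyond-4-bounds : α ≤ 1ℚ → ∀ {k d} → k ℕ.≤ d →
    α ^ℚ d * 𝟙 (4 ℕ.≤? k) ≤ 𝟙 (4 ℕ.≤? k) * α ^ℚ k × 𝟙 (4 ℕ.≤? k) * α ^ℚ k ≤ α ^ℚ 4 * 𝟙 (4 ℕ.≤? k)
  beyond-4-bounds α≤1 {k} {d} k≤d with 4 ℕ.≤? k
  ... | no _    = ≤-reflexive (trans (*-zeroʳ (α ^ℚ d)) (sym (*-zeroˡ (α ^ℚ k)))) ,
                  ≤-reflexive (trans (*-zeroˡ (α ^ℚ k)) (sym (*-zeroʳ (α ^ℚ 4))))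
  ... | yes 4≤k = lower , upper
    where
    open ≤-Reasoning
    lower : α ^ℚ d * 1ℚ ≤ 1ℚ * α ^ℚ k
    lower = begin
      α ^ℚ d * 1ℚ   ≡⟨ *-identityʳ (α ^ℚ d) ⟩
      α ^ℚ d        ≤⟨ ^ℚ-antitone α≤1 k≤d ⟩
      α ^ℚ k        ≡⟨ *-identityˡ (α ^ℚ k) ⟨
      1ℚ * α ^ℚ k   ∎
    upper : 1ℚ * α ^ℚ k ≤ α ^ℚ 4 * 1ℚ
    upper = begin
      1ℚ * α ^ℚ k   ≡⟨ *-identityˡ (α ^ℚ k) ⟩
      α ^ℚ k        ≤⟨ ^ℚ-antitone α≤1 4≤k ⟩
      α ^ℚ 4        ≡⟨ *-identityʳ (α ^ℚ 4) ⟨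
      α ^ℚ 4 * 1ℚ   ∎

beyond-4-exact : (α : ℚ) → ∀ {k d} → k ℕ.≤ d → d ℕ.≤ 4 →
  α ^ℚ d * 𝟙 (4 ℕ.≤? k) ≡ 𝟙 (4 ℕ.≤? k) * α ^ℚ k × 𝟙 (4 ℕ.≤? k) * α ^ℚ k ≡ α ^ℚ 4 * 𝟙 (4 ℕ.≤? k)
beyond-4-exact α {k} {d} k≤d d≤4 with 4 ℕ.≤? k
... | no _    = trans (*-zeroʳ (α ^ℚ d)) (sym (*-zeroˡ (α ^ℚ k))) , trans (*-zeroˡ (α ^ℚ k)) (sym (*-zeroʳ (α ^ℚ 4)))
... | yes 4≤k with ℕ.≤-antisym (ℕ.≤-trans k≤d d≤4) 4≤k | ℕ.≤-antisym d≤4 (ℕ.≤-trans 4≤k k≤d)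
...   | refl | refl = *-comm (α ^ℚ 4) 1ℚ , *-comm 1ℚ (α ^ℚ 4)

split-at-4 : (f : ℕ → ℚ) (k : ℕ) → k ≢ 0 →
  f k ≡ f 1 * 𝟙 (k ℕ.≟ 1) + f 2 * 𝟙 (k ℕ.≟ 2) + f 3 * 𝟙 (k ℕ.≟ 3) + 𝟙 (4 ℕ.≤? k) * f k
split-at-4 f 0 k≢0 = contradiction refl k≢0
split-at-4 f 1 _   = at-1 (f 1) (f 2) (f 3)
  where
  at-1 : ∀ x y z → x ≡ x * 1ℚ + y * 0ℚ + z * 0ℚ + 0ℚ * x
  at-1 = solve-∀ ℚ-ring
split-at-4 f 2 _   = at-2 (f 1) (f 2) (f 3)
  where
  at-2 : ∀ x y z → y ≡ x * 0ℚ + y * 1ℚ + z * 0ℚ + 0ℚ * y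
  at-2 = solve-∀ ℚ-ring
split-at-4 f 3 _   = at-3 (f 1) (f 2) (f 3)
  where
  at-3 : ∀ x y z → z ≡ x * 0ℚ + y * 0ℚ + z * 1ℚ + 0ℚ * z
  at-3 = solve-∀ ℚ-ring
split-at-4 f k@(suc (suc (suc (suc _)))) _ = beyond-3 (f 1) (f 2) (f 3) (f k)
  where
  beyond-3 : ∀ x y z w → w ≡ x * 0ℚ + y * 0ℚ + z * 0ℚ + 1ℚ * w
  beyond-3 = solve-∀ ℚ-ring

open CommutativeRing +-*-commutativeRing using (semiring)
open import Algebra.Properties.Semiring.Sum semiring
  using (sum; sum-syntax; sum-cong-≗; sum-replicate-zero; ∑-distrib-+; ∑-comm; *-distribˡ-sum; *-distribʳ-sum)

private
  variable
    n : ℕ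

∑-zero : {f : Fin n → ℚ} → (∀ i → f i ≡ 0ℚ) → ∑[ i < n ] f i ≡ 0ℚ
∑-zero {n} f≡0 = trans (sum-cong-≗ f≡0) (sum-replicate-zero n)

∑-single : (f : Fin n → ℚ) (i : Fin n) → (∀ j → j ≢ i → f j ≡ 0ℚ) → ∑[ j < n ] f j ≡ f i
∑-single f zero    f≡0 =
  trans (cong (λ z → f zero + z) (∑-zero (λ j → f≡0 (suc j) λ ()))) (+-identityʳ (f zero))
∑-single f (suc i) f≡0 =
  trans (cong₂ _+_ (f≡0 zero λ ()) (∑-single (f ∘ suc) i (λ j j≢i → f≡0 (suc j) (j≢i ∘ Fin.suc-injective))))
        (+-identityˡ (f (suc i)))

∑-δ : (i : Fin n) (f : Fin n → ℚ) → ∑[ j < n ] (𝟙 (i ≟ᶠ j) * f j) ≡ f i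
∑-δ i f = trans (∑-single _ i off-i) (trans (cong (_* f i) (𝟙-yes (i ≟ᶠ i) refl)) (*-identityˡ (f i)))
  where
  off-i : ∀ j → j ≢ i → 𝟙 (i ≟ᶠ j) * f j ≡ 0ℚ
  off-i j j≢i = trans (cong (_* f j) (𝟙-no (i ≟ᶠ j) (j≢i ∘ sym))) (*-zeroˡ (f j))

∑-distrib-− : (f g : Fin n → ℚ) → ∑[ i < n ] (f i - g i) ≡ ∑[ i < n ] f i - ∑[ i < n ] g i
∑-distrib-− {zero}  f g = refl
∑-distrib-− {suc n} f g =
  trans (cong (λ z → (f zero - g zero) + z) (∑-distrib-− (f ∘ suc) (g ∘ suc)))
        (interchange (f zero) (g zero) (∑[ i < n ] f (suc i)) (∑[ i < n ] g (suc i)))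
  where
  interchange : ∀ a b c d → (a - b) + (c - d) ≡ (a + c) - (b + d)
  interchange = solve-∀ ℚ-ring

∑-mono-≤ : {f g : Fin n → ℚ} → (∀ i → f i ≤ g i) → ∑[ i < n ] f i ≤ ∑[ i < n ] g i
∑-mono-≤ {zero}  _   = ≤-refl
∑-mono-≤ {suc n} f≤g = +-mono-≤ (f≤g zero) (∑-mono-≤ (f≤g ∘ suc))

∑-one : ∑[ i < n ] 1ℚ ≡ fromℕ n
∑-one {zero}  = refl
∑-one {suc n} = trans (cong (λ z → 1ℚ + z) (∑-one {n})) (sym (fromℕ-suc n))

sumℚ-allFin : (f : Fin n → ℚ) → sumℚ (map f (allFin n)) ≡ ∑[ i < n ] f i
sumℚ-allFin f = trans (cong sumℚ (List.map-tabulate (λ i → i) f)) (sumℚ-tabulate f)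
  where
  sumℚ-tabulate : ∀ {n} (f : Fin n → ℚ) → sumℚ (tabulate f) ≡ ∑[ i < n ] f i
  sumℚ-tabulate {zero}  f = refl
  sumℚ-tabulate {suc n} f = cong (λ z → f zero + z) (sumℚ-tabulate (f ∘ suc))

sumℚ-++ : (xs ys : List ℚ) → sumℚ (xs ++ ys) ≡ sumℚ xs + sumℚ ys
sumℚ-++ []       ys = sym (+-identityˡ (sumℚ ys))
sumℚ-++ (x ∷ xs) ys = trans (cong (λ z → x + z) (sumℚ-++ xs ys)) (sym (+-assoc x (sumℚ xs) (sumℚ ys)))

module _ {A : Set} where

  sumℚ-filter : {P : A → Set} (P? : Decidable P) (f : A → ℚ) (xs : List A) →
                sumℚ (map f (filter P? xs)) ≡ sumℚ (map (λ x → 𝟙 (P? x) * f x) xs)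
  sumℚ-filter P? f []       = refl
  sumℚ-filter P? f (x ∷ xs) with P? x
  ... | yes _ = cong₂ _+_ (sym (*-identityˡ (f x))) (sumℚ-filter P? f xs)
  ... | no _  = trans (sumℚ-filter P? f xs) (sym (trans (cong (_+ _) (*-zeroˡ (f x))) (+-identityˡ _)))

  fromℕ-length : (xs : List A) → fromℕ (length xs) ≡ sumℚ (map (λ _ → 1ℚ) xs)
  fromℕ-length []       = refl
  fromℕ-length (x ∷ xs) = trans (fromℕ-suc (length xs)) (cong (λ z → 1ℚ + z) (fromℕ-length xs))

  fromℕ-sum : (f : A → ℕ) (xs : List A) → fromℕ (ℕ.sum (map f xs)) ≡ sumℚ (map (fromℕ ∘ f) xs)
  fromℕ-sum f []       = refl
  fromℕ-sum f (x ∷ xs) = trans (fromℕ-+ (f x) _) (cong (λ z → fromℕ (f x) + z) (fromℕ-sum f xs))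

sumℚ-pairs : {R : Fin n → Fin n → Set} (R? : ∀ i → Decidable (R i)) (h : Fin n × Fin n → ℚ) →
  sumℚ (map h (concatMap (λ i → map (i ,_) (filter (R? i) (allFin n))) (allFin n)))
    ≡ ∑[ i < n ] ∑[ j < n ] (𝟙 (R? i j) * h (i , j))
sumℚ-pairs {n} R? h = begin
  sumℚ (map h (concatMap row (allFin n)))                ≡⟨ sumℚ-concatMap (allFin n) ⟩
  sumℚ (map (λ i → sumℚ (map h (row i))) (allFin n))     ≡⟨ sumℚ-allFin (λ i → sumℚ (map h (row i))) ⟩
  ∑[ i < n ] sumℚ (map h (row i))                          ≡⟨ sum-cong-≗ row-sum ⟩
  ∑[ i < n ] ∑[ j < n ] (𝟙 (R? i j) * h (i , j))            ∎
  where
  open ≡-Reasoning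
  row : Fin n → List (Fin n × Fin n)
  row i = map (i ,_) (filter (R? i) (allFin n))
  sumℚ-concatMap : ∀ is → sumℚ (map h (concatMap row is)) ≡ sumℚ (map (λ i → sumℚ (map h (row i))) is)
  sumℚ-concatMap []       = refl
  sumℚ-concatMap (i ∷ is) = begin
    sumℚ (map h (row i ++ concatMap row is))                  ≡⟨ cong sumℚ (List.map-++ h (row i) _) ⟩
    sumℚ (map h (row i) ++ map h (concatMap row is))          ≡⟨ sumℚ-++ (map h (row i)) (map h (concatMap row is)) ⟩
    sumℚ (map h (row i)) + sumℚ (map h (concatMap row is))    ≡⟨ cong (λ z → sumℚ (map h (row i)) + z) (sumℚ-concatMap is) ⟩
    sumℚ (map (λ i → sumℚ (map h (row i))) (i ∷ is))          ∎
  row-sum : ∀ i → sumℚ (map h (row i)) ≡ ∑[ j < n ] (𝟙 (R? i j) * h (i , j))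
  row-sum i = begin
    sumℚ (map h (row i))                                      ≡⟨ cong sumℚ (List.map-∘ {g = h} {f = i ,_} (filter (R? i) (allFin n))) ⟨
    sumℚ (map (λ j → h (i , j)) (filter (R? i) (allFin n)))   ≡⟨ sumℚ-filter (R? i) _ (allFin n) ⟩
    sumℚ (map (λ j → 𝟙 (R? i j) * h (i , j)) (allFin n))       ≡⟨ sumℚ-allFin (λ j → 𝟙 (R? i j) * h (i , j)) ⟩
    ∑[ j < n ] (𝟙 (R? i j) * h (i , j))                          ∎

∑∑-distrib-+ : (F H : Fin n → Fin n → ℚ) →
  ∑[ i < n ] ∑[ j < n ] (F i j + H i j) ≡ ∑[ i < n ] ∑[ j < n ] F i j + ∑[ i < n ] ∑[ j < n ] H i j
∑∑-distrib-+ {n} F H = trans (sum-cong-≗ (λ i → ∑-distrib-+ (F i) (H i)))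
                             (∑-distrib-+ (λ i → ∑[ j < n ] F i j) (λ i → ∑[ j < n ] H i j))

∑∑-distrib-− : (F H : Fin n → Fin n → ℚ) →
  ∑[ i < n ] ∑[ j < n ] (F i j - H i j) ≡ ∑[ i < n ] ∑[ j < n ] F i j - ∑[ i < n ] ∑[ j < n ] H i j
∑∑-distrib-− {n} F H = trans (sum-cong-≗ (λ i → ∑-distrib-− (F i) (H i)))
                             (∑-distrib-− (λ i → ∑[ j < n ] F i j) (λ i → ∑[ j < n ] H i j))

∑∑-product : (x y : Fin n → ℚ) → ∑[ i < n ] ∑[ j < n ] (x i * y j) ≡ ∑[ i < n ] x i * ∑[ j < n ] y j
∑∑-product {n} x y = begin
  ∑[ i < n ] ∑[ j < n ] (x i * y j)     ≡⟨ sum-cong-≗ (λ i → *-distribˡ-sum (x i) y) ⟨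
  ∑[ i < n ] (x i * ∑[ j < n ] y j)     ≡⟨ *-distribʳ-sum (∑[ j < n ] y j) x ⟨
  ∑[ i < n ] x i * ∑[ j < n ] y j       ∎
  where open ≡-Reasoning

∑∑-comm-∑∑ : (F : Fin n → Fin n → Fin n → Fin n → ℚ) →
  ∑[ i < n ] ∑[ j < n ] ∑[ a < n ] ∑[ b < n ] F i j a b ≡ ∑[ a < n ] ∑[ b < n ] ∑[ i < n ] ∑[ j < n ] F i j a b
∑∑-comm-∑∑ {n} F = begin
  ∑[ i < n ] ∑[ j < n ] ∑[ a < n ] ∑[ b < n ] F i j a b
    ≡⟨ sum-cong-≗ (λ i → ∑-comm (λ j a → ∑[ b < n ] F i j a b)) ⟩
  ∑[ i < n ] ∑[ a < n ] ∑[ j < n ] ∑[ b < n ] F i j a b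
    ≡⟨ ∑-comm (λ i a → ∑[ j < n ] ∑[ b < n ] F i j a b) ⟩
  ∑[ a < n ] ∑[ i < n ] ∑[ j < n ] ∑[ b < n ] F i j a b
    ≡⟨ sum-cong-≗ (λ a → sum-cong-≗ (λ i → ∑-comm (λ j b → F i j a b))) ⟩
  ∑[ a < n ] ∑[ i < n ] ∑[ b < n ] ∑[ j < n ] F i j a b
    ≡⟨ sum-cong-≗ (λ a → ∑-comm (λ i b → ∑[ j < n ] F i j a b)) ⟩
  ∑[ a < n ] ∑[ b < n ] ∑[ i < n ] ∑[ j < n ] F i j a b ∎
  where open ≡-Reasoning

𝟙≢ : Fin n → Fin n → ℚ
𝟙≢ i j = 𝟙 (¬? (i ≟ᶠ j))

∑≠ : (Fin n → Fin n → ℚ) → ℚ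
∑≠ {n} F = ∑[ i < n ] ∑[ j < n ] (𝟙≢ i j * F i j)

pairSum≡∑≠ : (dist : Fin n → Fin n → ℕ) (f : ℕ → ℚ) → pairSum dist f ≡ ∑≠ (λ i j → f (dist i j))
pairSum≡∑≠ {n} dist f =
  trans (sumℚ-allFin (λ i → sumℚ (map (λ j → f (dist i j)) (filter (λ j → ¬? (i ≟ᶠ j)) (allFin n)))))
        (sum-cong-≗ row)
  where
  row : ∀ i → sumℚ (map (λ j → f (dist i j)) (filter (λ j → ¬? (i ≟ᶠ j)) (allFin n)))
            ≡ ∑[ j < n ] (𝟙≢ i j * f (dist i j))
  row i = trans (sumℚ-filter (λ j → ¬? (i ≟ᶠ j)) (λ j → f (dist i j)) (allFin n))
                (sumℚ-allFin (λ j → 𝟙≢ i j * f (dist i j)))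

∑≠-by-diagonal : (F : Fin n → Fin n → ℚ) → ∑≠ F ≡ ∑[ i < n ] ∑[ j < n ] F i j - ∑[ i < n ] F i i
∑≠-by-diagonal {n} F = trans (sum-cong-≗ row) (∑-distrib-− (λ i → ∑[ j < n ] F i j) (λ i → F i i))
  where
  row : ∀ i → ∑[ j < n ] (𝟙≢ i j * F i j) ≡ ∑[ j < n ] F i j - F i i
  row i = begin
    ∑[ j < n ] (𝟙≢ i j * F i j)                           ≡⟨ sum-cong-≗ (λ j → cong (_* F i j) (𝟙-¬ (i ≟ᶠ j))) ⟩
    ∑[ j < n ] ((1ℚ - 𝟙 (i ≟ᶠ j)) * F i j)                ≡⟨ sum-cong-≗ (λ j → distrib (𝟙 (i ≟ᶠ j)) (F i j)) ⟩
    ∑[ j < n ] (F i j - 𝟙 (i ≟ᶠ j) * F i j)               ≡⟨ ∑-distrib-− (F i) (λ j → 𝟙 (i ≟ᶠ j) * F i j) ⟩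
    ∑[ j < n ] F i j - ∑[ j < n ] (𝟙 (i ≟ᶠ j) * F i j)    ≡⟨ cong (λ z → ∑[ j < n ] F i j - z) (∑-δ i (F i)) ⟩
    ∑[ j < n ] F i j - F i i                              ∎
    where
    open ≡-Reasoning
    distrib : ∀ x y → (1ℚ - x) * y ≡ y - x * y
    distrib = solve-∀ ℚ-ring

module _ {F H : Fin n → Fin n → ℚ} where

  ∑≠-cong : (∀ i j → i ≢ j → F i j ≡ H i j) → ∑≠ F ≡ ∑≠ H
  ∑≠-cong F≡H = sum-cong-≗ (λ i → sum-cong-≗ (entry i))
    where
    entry : ∀ i j → 𝟙≢ i j * F i j ≡ 𝟙≢ i j * H i j
    entry i j with i ≟ᶠ j
    ... | yes _   = trans (*-zeroˡ (F i j)) (sym (*-zeroˡ (H i j)))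
    ... | no i≢j  = cong (1ℚ *_) (F≡H i j i≢j)

  ∑≠-mono-≤ : (∀ i j → i ≢ j → F i j ≤ H i j) → ∑≠ F ≤ ∑≠ H
  ∑≠-mono-≤ F≤H = ∑-mono-≤ (λ i → ∑-mono-≤ (entry i))
    where
    entry : ∀ i j → 𝟙≢ i j * F i j ≤ 𝟙≢ i j * H i j
    entry i j with i ≟ᶠ j
    ... | yes _  = ≤-reflexive (trans (*-zeroˡ (F i j)) (sym (*-zeroˡ (H i j))))
    ... | no i≢j = *-monoˡ-≤-nonNeg 1ℚ (F≤H i j i≢j)

∑≠-distrib-+ : (F H : Fin n → Fin n → ℚ) → ∑≠ (λ i j → F i j + H i j) ≡ ∑≠ F + ∑≠ H
∑≠-distrib-+ F H = trans (sum-cong-≗ (λ i → sum-cong-≗ (λ j → *-distribˡ-+ (𝟙≢ i j) (F i j) (H i j))))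
                         (∑∑-distrib-+ (λ i j → 𝟙≢ i j * F i j) (λ i j → 𝟙≢ i j * H i j))

∑≠-*ˡ : (c : ℚ) (F : Fin n → Fin n → ℚ) → ∑≠ (λ i j → c * F i j) ≡ c * ∑≠ F
∑≠-*ˡ {n} c F = begin
  ∑[ i < n ] ∑[ j < n ] (𝟙≢ i j * (c * F i j))  ≡⟨ sum-cong-≗ (λ i → sum-cong-≗ (λ j → swap (𝟙≢ i j) c (F i j))) ⟩
  ∑[ i < n ] ∑[ j < n ] (c * (𝟙≢ i j * F i j))  ≡⟨ sum-cong-≗ (λ i → *-distribˡ-sum c (λ j → 𝟙≢ i j * F i j)) ⟨
  ∑[ i < n ] (c * ∑[ j < n ] (𝟙≢ i j * F i j))  ≡⟨ *-distribˡ-sum c (λ i → ∑[ j < n ] (𝟙≢ i j * F i j)) ⟨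
  c * ∑≠ F                                       ∎
  where
  open ≡-Reasoning
  swap : ∀ x y z → x * (y * z) ≡ y * (x * z)
  swap = solve-∀ ℚ-ring

∑≠-one : ∑≠ {n} (λ _ _ → 1ℚ) ≡ fromℕ n * (fromℕ n - 1ℚ)
∑≠-one {n} = begin
  ∑≠ {n} (λ _ _ → 1ℚ)                               ≡⟨ ∑≠-by-diagonal {n} (λ _ _ → 1ℚ) ⟩
  ∑[ i < n ] ∑[ j < n ] 1ℚ - ∑[ i < n ] 1ℚ           ≡⟨ cong₂ _-_ all-pairs (∑-one {n}) ⟩
  fromℕ n * fromℕ n - fromℕ n                        ≡⟨ factor (fromℕ n) ⟩
  fromℕ n * (fromℕ n - 1ℚ)                           ∎
  where
  open ≡-Reasoning
  all-pairs : ∑[ i < n ] ∑[ j < n ] 1ℚ ≡ fromℕ n * fromℕ n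
  all-pairs = begin
    ∑[ i < n ] ∑[ j < n ] 1ℚ       ≡⟨ sum-cong-≗ {n} (λ _ → trans (∑-one {n}) (sym (*-identityˡ (fromℕ n)))) ⟩
    ∑[ i < n ] (1ℚ * fromℕ n)      ≡⟨ *-distribʳ-sum {n} (fromℕ n) (λ _ → 1ℚ) ⟨
    ∑[ i < n ] 1ℚ * fromℕ n        ≡⟨ cong (_* fromℕ n) (∑-one {n}) ⟩
    fromℕ n * fromℕ n              ∎
  factor : ∀ x → x * x - x ≡ x * (x - 1ℚ)
  factor = solve-∀ ℚ-ring

∑𝟙-unique : {P : Fin n → Set} (P? : Decidable P) (Q? : Dec Q) →
            (∀ {a} → P a → Q) → (Q → ∃ λ a₀ → P a₀ × ∀ {a} → P a → a ≡ a₀) →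
            ∑[ a < n ] 𝟙 (P? a) ≡ 𝟙 Q?
∑𝟙-unique P? (no ¬q) P⇒Q _      = ∑-zero (λ a → 𝟙-no (P? a) (¬q ∘ P⇒Q))
∑𝟙-unique P? (yes q) _   Q⇒∃! with Q⇒∃! q
... | a₀ , Pa₀ , unique =
  trans (∑-single _ a₀ (λ a a≢a₀ → 𝟙-no (P? a) (a≢a₀ ∘ unique))) (𝟙-yes (P? a₀) Pa₀)

∑∑𝟙-unique : {P : Fin n → Fin n → Set} (P? : ∀ a b → Dec (P a b)) (Q? : Dec Q) →
             (∀ {a b} → P a b → Q) →
             (Q → ∃₂ λ a₀ b₀ → P a₀ b₀ × ∀ {a b} → P a b → a ≡ a₀ × b ≡ b₀) →
             ∑[ a < n ] ∑[ b < n ] 𝟙 (P? a b) ≡ 𝟙 Q?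
∑∑𝟙-unique P? (no ¬q) P⇒Q _ = ∑-zero (λ a → ∑-zero (λ b → 𝟙-no (P? a b) (¬q ∘ P⇒Q)))
∑∑𝟙-unique P? (yes q) _   Q⇒∃! with Q⇒∃! q
... | a₀ , b₀ , Pa₀b₀ , unique =
  trans (∑-single _ a₀ (λ a a≢a₀ → ∑-zero (λ b → 𝟙-no (P? a b) (a≢a₀ ∘ proj₁ ∘ unique))))
        (trans (∑-single _ b₀ (λ b b≢b₀ → 𝟙-no (P? a₀ b) (b≢b₀ ∘ proj₂ ∘ unique))) (𝟙-yes (P? a₀ b₀) Pa₀b₀))

exactly-one-<ᵇ : ∀ a b → a ≢ b → 𝟙 ((a <ᵇ b) ≟ᵇ true) + 𝟙 ((b <ᵇ a) ≟ᵇ true) ≡ 1ℚ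
exactly-one-<ᵇ zero    zero    a≢b = contradiction refl a≢b
exactly-one-<ᵇ zero    (suc b) _   = refl
exactly-one-<ᵇ (suc a) zero    _   = refl
exactly-one-<ᵇ (suc a) (suc b) a≢b = exactly-one-<ᵇ a b (a≢b ∘ cong suc)

linked-lookup : ∀ {A : Set} {R : A → A → Set} {k} {v : Vec A (suc k)} →
                Linked R v → (t : Fin k) → R (lookup v (inject₁ t)) (lookup v (suc t))
linked-lookup {v = _ ∷ _ ∷ _} (r ∷ _)  zero    = r
linked-lookup {v = _ ∷ _ ∷ _} (_ ∷ rs) (suc t) = linked-lookup rs t

module Adjacency {n : ℕ} (G : Graph n) where

  Adj? : ∀ i j → Dec (Adj G i j)
  Adj? i j = adj G i j ≟ᵇ true

  A : Fin n → Fin n → ℚ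
  A i j = 𝟙 (Adj? i j)

  deg : Fin n → ℚ
  deg i = ∑[ j < n ] A i j

  m m₁ m₂ : ℚ
  m  = fromℕ (numEdges G)
  m₁ = fromℕ (M₁ G)
  m₂ = fromℕ (M₂ G)

  A-sym : ∀ i j → A i j ≡ A j i
  A-sym i j = cong (λ b → 𝟙 (b ≟ᵇ true)) (Graph.sym G i j)

  A-irrefl : ∀ i → A i i ≡ 0ℚ
  A-irrefl i = cong (λ b → 𝟙 (b ≟ᵇ true)) (irrefl G i)

  degree≡deg : ∀ i → fromℕ (degree G i) ≡ deg i
  degree≡deg i = begin
    fromℕ (degree G i)                                   ≡⟨ fromℕ-length (filter (Adj? i) (allFin n)) ⟩
    sumℚ (map (λ _ → 1ℚ) (filter (Adj? i) (allFin n)))   ≡⟨ sumℚ-filter (Adj? i) (λ _ → 1ℚ) (allFin n) ⟩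
    sumℚ (map (λ j → A i j * 1ℚ) (allFin n))             ≡⟨ sumℚ-allFin (λ j → A i j * 1ℚ) ⟩
    ∑[ j < n ] (A i j * 1ℚ)                              ≡⟨ sum-cong-≗ (λ j → *-identityʳ (A i j)) ⟩
    deg i                                                ∎
    where open ≡-Reasoning

  degree*degree≡deg*deg : ∀ i j → fromℕ (degree G i ℕ.* degree G j) ≡ deg i * deg j
  degree*degree≡deg*deg i j = trans (fromℕ-* (degree G i) (degree G j)) (cong₂ _*_ (degree≡deg i) (degree≡deg j))

  m₁≡∑deg² : m₁ ≡ ∑[ i < n ] (deg i * deg i)
  m₁≡∑deg² = trans (fromℕ-sum (λ i → degree G i ℕ.* degree G i) (allFin n))
                   (trans (sumℚ-allFin (λ i → fromℕ (degree G i ℕ.* degree G i))) (sum-cong-≗ (λ i → degree*degree≡deg*deg i i)))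

  Edge? : ∀ i j → Dec ((adj G i j ∧ (toℕ i <ᵇ toℕ j)) ≡ true)
  Edge? i j = (adj G i j ∧ (toℕ i <ᵇ toℕ j)) ≟ᵇ true

  A≡𝟙Edge+𝟙Edge : ∀ i j → A i j ≡ 𝟙 (Edge? i j) + 𝟙 (Edge? j i)
  A≡𝟙Edge+𝟙Edge i j with adj G i j in ij | adj G j i in ji
  ... | false | false = refl
  ... | false | true  = contradiction (trans (sym ij) (trans (Graph.sym G i j) ji)) λ ()
  ... | true  | false = contradiction (trans (sym ji) (trans (Graph.sym G j i) ij)) λ ()
  ... | true  | true  = sym (exactly-one-<ᵇ (toℕ i) (toℕ j) (i≢j ∘ Fin.toℕ-injective))
    where
    i≢j : i ≢ j
    i≢j refl = contradiction (trans (sym ij) (irrefl G i)) λ ()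

  ∑∑A≡2∑edges : (h : Fin n → Fin n → ℚ) → (∀ i j → h i j ≡ h j i) →
    ∑[ i < n ] ∑[ j < n ] (A i j * h i j) ≡ fromℕ 2 * sumℚ (map (uncurry h) (edges G))
  ∑∑A≡2∑edges h h-sym = begin
    ∑[ i < n ] ∑[ j < n ] (A i j * h i j)
      ≡⟨ sum-cong-≗ (λ i → sum-cong-≗ (λ j → trans (cong (_* h i j) (A≡𝟙Edge+𝟙Edge i j))
                                                    (*-distribʳ-+ (h i j) (E i j) (E j i)))) ⟩
    ∑[ i < n ] ∑[ j < n ] (E i j * h i j + E j i * h i j)
      ≡⟨ ∑∑-distrib-+ (λ i j → E i j * h i j) (λ i j → E j i * h i j) ⟩
    S + ∑[ i < n ] ∑[ j < n ] (E j i * h i j)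
      ≡⟨ cong (λ z → S + z) (∑-comm (λ i j → E j i * h i j)) ⟩
    S + ∑[ j < n ] ∑[ i < n ] (E j i * h i j)
      ≡⟨ cong (λ z → S + z) (sum-cong-≗ (λ j → sum-cong-≗ (λ i → cong (E j i *_) (h-sym i j)))) ⟩
    S + S
      ≡⟨ double S ⟩
    fromℕ 2 * S
      ≡⟨ cong (fromℕ 2 *_) (sumℚ-pairs Edge? (uncurry h)) ⟨
    fromℕ 2 * sumℚ (map (uncurry h) (edges G)) ∎
    where
    open ≡-Reasoning
    E : Fin n → Fin n → ℚ
    E i j = 𝟙 (Edge? i j)
    S : ℚ
    S = ∑[ i < n ] ∑[ j < n ] (E i j * h i j)
    double : ∀ x → x + x ≡ fromℕ 2 * x
    double = solve-∀ ℚ-ring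

  handshake : ∑[ i < n ] deg i ≡ fromℕ 2 * m
  handshake = begin
    ∑[ i < n ] deg i                                  ≡⟨ sum-cong-≗ (λ i → sum-cong-≗ (λ j → *-identityʳ (A i j))) ⟨
    ∑[ i < n ] ∑[ j < n ] (A i j * 1ℚ)                ≡⟨ ∑∑A≡2∑edges (λ _ _ → 1ℚ) (λ _ _ → refl) ⟩
    fromℕ 2 * sumℚ (map (λ _ → 1ℚ) (edges G))         ≡⟨ cong (fromℕ 2 *_) (fromℕ-length (edges G)) ⟨
    fromℕ 2 * m                                       ∎
    where open ≡-Reasoning

  ∑∑A·deg·deg≡2m₂ : ∑[ i < n ] ∑[ j < n ] (A i j * (deg i * deg j)) ≡ fromℕ 2 * m₂
  ∑∑A·deg·deg≡2m₂ = begin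
    ∑[ i < n ] ∑[ j < n ] (A i j * (deg i * deg j))
      ≡⟨ ∑∑A≡2∑edges (λ i j → deg i * deg j) (λ i j → *-comm (deg i) (deg j)) ⟩
    fromℕ 2 * sumℚ (map (uncurry (λ i j → deg i * deg j)) (edges G))
      ≡⟨ cong (λ xs → fromℕ 2 * sumℚ xs) (List.map-cong (λ { (i , j) → sym (degree*degree≡deg*deg i j) }) (edges G)) ⟩
    fromℕ 2 * sumℚ (map (fromℕ ∘ λ { (i , j) → degree G i ℕ.* degree G j }) (edges G))
      ≡⟨ cong (fromℕ 2 *_) (fromℕ-sum _ (edges G)) ⟨
    fromℕ 2 * m₂ ∎
    where open ≡-Reasoning

  ∑∑deg·A≡m₁ : ∑[ a < n ] ∑[ b < n ] (deg a * A a b) ≡ m₁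
  ∑∑deg·A≡m₁ = trans (sum-cong-≗ (λ a → sym (*-distribˡ-sum (deg a) (A a)))) (sym m₁≡∑deg²)

  ∑∑A·deg≡m₁ : ∑[ a < n ] ∑[ b < n ] (A a b * deg b) ≡ m₁
  ∑∑A·deg≡m₁ = begin
    ∑[ a < n ] ∑[ b < n ] (A a b * deg b)     ≡⟨ ∑-comm (λ a b → A a b * deg b) ⟩
    ∑[ b < n ] ∑[ a < n ] (A a b * deg b)     ≡⟨ sum-cong-≗ (λ b → *-distribʳ-sum (deg b) (λ a → A a b)) ⟨
    ∑[ b < n ] (∑[ a < n ] A a b * deg b)     ≡⟨ sum-cong-≗ (λ b → cong (_* deg b) (sum-cong-≗ (λ a → A-sym a b))) ⟩
    ∑[ b < n ] (deg b * deg b)                ≡⟨ m₁≡∑deg² ⟨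
    m₁                                        ∎
    where open ≡-Reasoning

  ∑≠A≡2m : ∑≠ A ≡ fromℕ 2 * m
  ∑≠A≡2m = begin
    ∑≠ A                                      ≡⟨ ∑≠-by-diagonal A ⟩
    ∑[ i < n ] deg i - ∑[ i < n ] A i i       ≡⟨ cong₂ _-_ handshake (∑-zero A-irrefl) ⟩
    fromℕ 2 * m - 0ℚ                          ≡⟨ +-identityʳ (fromℕ 2 * m) ⟩
    fromℕ 2 * m                               ∎
    where open ≡-Reasoning

  Path₂ : Fin n → Fin n → Fin n → Set
  Path₂ i a j = Adj G i a × Adj G a j

  Path₂? : ∀ i a j → Dec (Path₂ i a j)
  Path₂? i a j = Adj? i a ×-dec Adj? a j

  paths₂ : Fin n → Fin n → ℚ
  paths₂ i j = ∑[ a < n ] 𝟙 (Path₂? i a j)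

  paths₂≡∑AA : ∀ i j → paths₂ i j ≡ ∑[ a < n ] (A i a * A a j)
  paths₂≡∑AA i j = sum-cong-≗ (λ a → 𝟙-× (Adj? i a) (Adj? a j))

  ∑≠paths₂≡m₁-2m : ∑≠ paths₂ ≡ m₁ - fromℕ 2 * m
  ∑≠paths₂≡m₁-2m = begin
    ∑≠ paths₂                                                  ≡⟨ ∑≠-by-diagonal paths₂ ⟩
    ∑[ i < n ] ∑[ j < n ] paths₂ i j - ∑[ i < n ] paths₂ i i   ≡⟨ cong₂ _-_ all-pairs diagonal ⟩
    m₁ - fromℕ 2 * m                                           ∎
    where
    open ≡-Reasoning
    all-pairs : ∑[ i < n ] ∑[ j < n ] paths₂ i j ≡ m₁
    all-pairs = begin
      ∑[ i < n ] ∑[ j < n ] paths₂ i j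
        ≡⟨ sum-cong-≗ (λ i → sum-cong-≗ (paths₂≡∑AA i)) ⟩
      ∑[ i < n ] ∑[ j < n ] ∑[ a < n ] (A i a * A a j)
        ≡⟨ sum-cong-≗ (λ i → ∑-comm (λ j a → A i a * A a j)) ⟩
      ∑[ i < n ] ∑[ a < n ] ∑[ j < n ] (A i a * A a j)
        ≡⟨ ∑-comm (λ i a → ∑[ j < n ] (A i a * A a j)) ⟩
      ∑[ a < n ] ∑[ i < n ] ∑[ j < n ] (A i a * A a j)
        ≡⟨ sum-cong-≗ (λ a → ∑∑-product (λ i → A i a) (A a)) ⟩
      ∑[ a < n ] (∑[ i < n ] A i a * deg a)
        ≡⟨ sum-cong-≗ (λ a → cong (_* deg a) (sum-cong-≗ (λ i → A-sym i a))) ⟩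
      ∑[ a < n ] (deg a * deg a)
        ≡⟨ m₁≡∑deg² ⟨
      m₁ ∎
    diagonal : ∑[ i < n ] paths₂ i i ≡ fromℕ 2 * m
    diagonal = trans (sum-cong-≗ (λ i → trans (paths₂≡∑AA i i) (sum-cong-≗ (loop i)))) handshake
      where
      loop : ∀ i a → A i a * A a i ≡ A i a
      loop i a = trans (cong (A i a *_) (A-sym a i)) (𝟙-idem (Adj? i a))

  Path₃ : Fin n → Fin n → Fin n → Fin n → Set
  Path₃ i a b j = Adj G i a × Adj G a b × Adj G b j × b ≢ i × a ≢ j

  Path₃? : ∀ i a b j → Dec (Path₃ i a b j)
  Path₃? i a b j = Adj? i a ×-dec Adj? a b ×-dec Adj? b j ×-dec ¬? (b ≟ᶠ i) ×-dec ¬? (a ≟ᶠ j)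

  paths₃ : Fin n → Fin n → ℚ
  paths₃ i j = ∑[ a < n ] ∑[ b < n ] 𝟙 (Path₃? i a b j)

  𝟙Path₃-split : ∀ i a b j → 𝟙 (Path₃? i a b j) ≡ A a b * ((A a i * 𝟙≢ b i) * (A b j * 𝟙≢ a j))
  𝟙Path₃-split i a b j = begin
    𝟙 (Path₃? i a b j)
      ≡⟨ trans (𝟙-× (Adj? i a) _) (cong (A i a *_) (trans (𝟙-× (Adj? a b) _)
           (cong (A a b *_) (trans (𝟙-× (Adj? b j) _) (cong (A b j *_) (𝟙-× (¬? (b ≟ᶠ i)) _)))))) ⟩
    A i a * (A a b * (A b j * (𝟙≢ b i * 𝟙≢ a j)))
      ≡⟨ cong (_* (A a b * (A b j * (𝟙≢ b i * 𝟙≢ a j)))) (A-sym i a) ⟩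
    A a i * (A a b * (A b j * (𝟙≢ b i * 𝟙≢ a j)))
      ≡⟨ regroup (A a i) (A a b) (A b j) (𝟙≢ b i) (𝟙≢ a j) ⟩
    A a b * ((A a i * 𝟙≢ b i) * (A b j * 𝟙≢ a j))       ∎
    where
    open ≡-Reasoning
    regroup : ∀ u v w x y → u * (v * (w * (x * y))) ≡ v * ((u * x) * (w * y))
    regroup = solve-∀ ℚ-ring

  ∑A-except : ∀ k l → ∑[ j < n ] (A k j * 𝟙≢ l j) ≡ deg k - A k l
  ∑A-except k l = begin
    ∑[ j < n ] (A k j * 𝟙≢ l j)                     ≡⟨ sum-cong-≗ (λ j → cong (A k j *_) (𝟙-¬ (l ≟ᶠ j))) ⟩
    ∑[ j < n ] (A k j * (1ℚ - 𝟙 (l ≟ᶠ j)))          ≡⟨ sum-cong-≗ (λ j → distrib (A k j) (𝟙 (l ≟ᶠ j))) ⟩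
    ∑[ j < n ] (A k j - 𝟙 (l ≟ᶠ j) * A k j)         ≡⟨ ∑-distrib-− (A k) (λ j → 𝟙 (l ≟ᶠ j) * A k j) ⟩
    deg k - ∑[ j < n ] (𝟙 (l ≟ᶠ j) * A k j)         ≡⟨ cong (λ z → deg k - z) (∑-δ l (A k)) ⟩
    deg k - A k l                                   ∎
    where
    open ≡-Reasoning
    distrib : ∀ x y → x * (1ℚ - y) ≡ x - y * x
    distrib = solve-∀ ℚ-ring

  -- A path i a b j amounts to a neighbour i ≠ b of a and a neighbour j ≠ a of b, chosen independently.
  paths₃-through : ∀ a b → ∑[ i < n ] ∑[ j < n ] 𝟙 (Path₃? i a b j) ≡ A a b * ((deg a - 1ℚ) * (deg b - 1ℚ))
  paths₃-through a b = begin
    ∑[ i < n ] ∑[ j < n ] 𝟙 (Path₃? i a b j)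
      ≡⟨ sum-cong-≗ (λ i → sum-cong-≗ (λ j → 𝟙Path₃-split i a b j)) ⟩
    ∑[ i < n ] ∑[ j < n ] (A a b * ((A a i * 𝟙≢ b i) * (A b j * 𝟙≢ a j)))
      ≡⟨ sum-cong-≗ (λ i → *-distribˡ-sum (A a b) (λ j → (A a i * 𝟙≢ b i) * (A b j * 𝟙≢ a j))) ⟨
    ∑[ i < n ] (A a b * ∑[ j < n ] ((A a i * 𝟙≢ b i) * (A b j * 𝟙≢ a j)))
      ≡⟨ *-distribˡ-sum (A a b) (λ i → ∑[ j < n ] ((A a i * 𝟙≢ b i) * (A b j * 𝟙≢ a j))) ⟨
    A a b * ∑[ i < n ] ∑[ j < n ] ((A a i * 𝟙≢ b i) * (A b j * 𝟙≢ a j))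
      ≡⟨ cong (A a b *_) (∑∑-product (λ i → A a i * 𝟙≢ b i) (λ j → A b j * 𝟙≢ a j)) ⟩
    A a b * (∑[ i < n ] (A a i * 𝟙≢ b i) * ∑[ j < n ] (A b j * 𝟙≢ a j))
      ≡⟨ cong (A a b *_) (cong₂ _*_ (∑A-except a b) (trans (∑A-except b a) (cong (λ z → deg b - z) (A-sym b a)))) ⟩
    A a b * ((deg a - A a b) * (deg b - A a b))
      ≡⟨ 𝟙-absorb (Adj? a b) (deg a) (deg b) ⟩
    A a b * ((deg a - 1ℚ) * (deg b - 1ℚ)) ∎
    where open ≡-Reasoning

  ∑∑A[deg-1][deg-1] : ∑[ a < n ] ∑[ b < n ] (A a b * ((deg a - 1ℚ) * (deg b - 1ℚ)))
                      ≡ fromℕ 2 * m₂ - fromℕ 2 * m₁ + fromℕ 2 * m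
  ∑∑A[deg-1][deg-1] = begin
    ∑[ a < n ] ∑[ b < n ] (A a b * ((deg a - 1ℚ) * (deg b - 1ℚ)))
      ≡⟨ sum-cong-≗ (λ a → sum-cong-≗ (λ b → expand (A a b) (deg a) (deg b))) ⟩
    ∑[ a < n ] ∑[ b < n ] ((A a b * (deg a * deg b) - (deg a * A a b + A a b * deg b)) + A a b)
      ≡⟨ ∑∑-distrib-+ (λ a b → A a b * (deg a * deg b) - (deg a * A a b + A a b * deg b)) A ⟩
    ∑[ a < n ] ∑[ b < n ] (A a b * (deg a * deg b) - (deg a * A a b + A a b * deg b)) + ∑[ a < n ] deg a
      ≡⟨ cong (_+ ∑[ a < n ] deg a) (trans (∑∑-distrib-− AΔΔ (λ a b → deg a * A a b + A a b * deg b))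
           (cong (∑[ a < n ] ∑[ b < n ] AΔΔ a b -_) (∑∑-distrib-+ (λ a b → deg a * A a b) (λ a b → A a b * deg b)))) ⟩
    (∑[ a < n ] ∑[ b < n ] AΔΔ a b - (∑[ a < n ] ∑[ b < n ] (deg a * A a b) + ∑[ a < n ] ∑[ b < n ] (A a b * deg b)))
      + ∑[ a < n ] deg a
      ≡⟨ cong₂ _+_ (cong₂ _-_ ∑∑A·deg·deg≡2m₂ (cong₂ _+_ ∑∑deg·A≡m₁ ∑∑A·deg≡m₁)) handshake ⟩
    (fromℕ 2 * m₂ - (m₁ + m₁)) + fromℕ 2 * m
      ≡⟨ rearrange m₂ m₁ m ⟩
    fromℕ 2 * m₂ - fromℕ 2 * m₁ + fromℕ 2 * m ∎
    where
    open ≡-Reasoning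
    AΔΔ : Fin n → Fin n → ℚ
    AΔΔ a b = A a b * (deg a * deg b)
    expand : ∀ e x y → e * ((x - 1ℚ) * (y - 1ℚ)) ≡ (e * (x * y) - (x * e + e * y)) + e
    expand = solve-∀ ℚ-ring
    rearrange : ∀ x y z → (fromℕ 2 * x - (y + y)) + fromℕ 2 * z ≡ fromℕ 2 * x - fromℕ 2 * y + fromℕ 2 * z
    rearrange = solve-∀ ℚ-ring

  ∑≠paths₃≡2m₂-2m₁+2m : (∀ i → paths₃ i i ≡ 0ℚ) →
                        ∑≠ paths₃ ≡ fromℕ 2 * m₂ - fromℕ 2 * m₁ + fromℕ 2 * m
  ∑≠paths₃≡2m₂-2m₁+2m diagonal = begin
    ∑≠ paths₃                                                                      ≡⟨ ∑≠-by-diagonal paths₃ ⟩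
    ∑[ i < n ] ∑[ j < n ] ∑[ a < n ] ∑[ b < n ] 𝟙 (Path₃? i a b j) - ∑[ i < n ] paths₃ i i
      ≡⟨ cong₂ _-_ (∑∑-comm-∑∑ (λ i j a b → 𝟙 (Path₃? i a b j))) (∑-zero diagonal) ⟩
    ∑[ a < n ] ∑[ b < n ] ∑[ i < n ] ∑[ j < n ] 𝟙 (Path₃? i a b j) - 0ℚ
      ≡⟨ +-identityʳ _ ⟩
    ∑[ a < n ] ∑[ b < n ] ∑[ i < n ] ∑[ j < n ] 𝟙 (Path₃? i a b j)
      ≡⟨ sum-cong-≗ (λ a → sum-cong-≗ (paths₃-through a)) ⟩
    ∑[ a < n ] ∑[ b < n ] (A a b * ((deg a - 1ℚ) * (deg b - 1ℚ)))
      ≡⟨ ∑∑A[deg-1][deg-1] ⟩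
    fromℕ 2 * m₂ - fromℕ 2 * m₁ + fromℕ 2 * m ∎
    where open ≡-Reasoning

module Walks {n : ℕ} (G : Graph n) where

  private
    variable
      i j : Fin n
      k : ℕ

  Adj⇒≢ : Adj G i j → i ≢ j
  Adj⇒≢ {i} i~i refl = contradiction (trans (sym i~i) (irrefl G i)) λ ()

  Adj-sym : Adj G i j → Adj G j i
  Adj-sym {i} {j} ij = trans (Graph.sym G j i) ij

  Shortest : Fin n → Fin n → ℕ → Set
  Shortest i j k = Walk G i j k × (∀ l → Walk G i j l → k ℕ.≤ l)

  shortest₀⇒≡ : Shortest i j 0 → i ≡ j
  shortest₀⇒≡ (nil , _) = refl

  Adj⇒shortest₁ : Adj G i j → Shortest i j k → k ≡ 1
  Adj⇒shortest₁ i~i (nil , _)                = contradiction refl (Adj⇒≢ i~i)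
  Adj⇒shortest₁ _   (cons _ nil , _)         = refl
  Adj⇒shortest₁ ij  (cons _ (cons _ _) , min) = contradiction (min 1 (cons ij nil)) λ { (s≤s ()) }

  shortest₁⇒Adj : Shortest i j 1 → Adj G i j
  shortest₁⇒Adj (cons ij nil , _) = ij

module ShortCycleFree {n : ℕ} (G : Graph n) (girth≥7 : GirthAtLeast G 7) where

  open Adjacency G
  open Walks G

  private
    variable
      a b c d e f i j : Fin n
      k : ℕ

  cycle : (v : Vec (Fin n) (3 ℕ.+ k)) → Unique v → Linked (Adj G) v →
          Adj G (lookup v (fromℕᶠ (2 ℕ.+ k))) (lookup v zero) → HasCycle G (3 ℕ.+ k)
  cycle v distinct consecutive closing =
    s≤s (s≤s (s≤s z≤n)) , lookup v , (λ {x} {y} → lookup-injective distinct x y) , linked-lookup consecutive , closing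

  no-short-cycle : k ℕ.≤ 3 → (v : Vec (Fin n) (3 ℕ.+ k)) → Unique v → Linked (Adj G) v →
                   Adj G (lookup v (fromℕᶠ (2 ℕ.+ k))) (lookup v zero) → ⊥
  no-short-cycle k≤3 v distinct consecutive closing =
    ℕ.<⇒≱ (s≤s (s≤s (s≤s (s≤s k≤3)))) (girth≥7 _ (cycle v distinct consecutive closing))

  no-triangle : Adj G a b → Adj G b c → Adj G c a → ⊥
  no-triangle ab bc ca = no-short-cycle z≤n (_ ∷ _ ∷ _ ∷ [])
    ((Adj⇒≢ ab ∷ ≢-sym (Adj⇒≢ ca) ∷ []) ∷ (Adj⇒≢ bc ∷ []) ∷ [] ∷ [])
    (ab ∷ bc ∷ [-]) ca

  no-square : Adj G a b → Adj G b c → Adj G c d → Adj G d a → a ≢ c → b ≢ d → ⊥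
  no-square ab bc cd da a≢c b≢d = no-short-cycle (s≤s z≤n) (_ ∷ _ ∷ _ ∷ _ ∷ [])
    ((Adj⇒≢ ab ∷ a≢c ∷ ≢-sym (Adj⇒≢ da) ∷ []) ∷ (Adj⇒≢ bc ∷ b≢d ∷ []) ∷ (Adj⇒≢ cd ∷ []) ∷ [] ∷ [])
    (ab ∷ bc ∷ cd ∷ [-]) da

  no-pentagon : Adj G a b → Adj G b c → Adj G c d → Adj G d e → Adj G e a →
                a ≢ c → a ≢ d → b ≢ d → b ≢ e → c ≢ e → ⊥
  no-pentagon ab bc cd de ea a≢c a≢d b≢d b≢e c≢e = no-short-cycle (s≤s (s≤s z≤n)) (_ ∷ _ ∷ _ ∷ _ ∷ _ ∷ [])
    ((Adj⇒≢ ab ∷ a≢c ∷ a≢d ∷ ≢-sym (Adj⇒≢ ea) ∷ []) ∷ (Adj⇒≢ bc ∷ b≢d ∷ b≢e ∷ []) ∷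
     (Adj⇒≢ cd ∷ c≢e ∷ []) ∷ (Adj⇒≢ de ∷ []) ∷ [] ∷ [])
    (ab ∷ bc ∷ cd ∷ de ∷ [-]) ea

  no-hexagon : Adj G a b → Adj G b c → Adj G c d → Adj G d e → Adj G e f → Adj G f a →
               a ≢ c → a ≢ d → a ≢ e → b ≢ d → b ≢ e → b ≢ f → c ≢ e → c ≢ f → d ≢ f → ⊥
  no-hexagon ab bc cd de ef fa a≢c a≢d a≢e b≢d b≢e b≢f c≢e c≢f d≢f =
    no-short-cycle (s≤s (s≤s (s≤s z≤n))) (_ ∷ _ ∷ _ ∷ _ ∷ _ ∷ _ ∷ [])
      ((Adj⇒≢ ab ∷ a≢c ∷ a≢d ∷ a≢e ∷ ≢-sym (Adj⇒≢ fa) ∷ []) ∷ (Adj⇒≢ bc ∷ b≢d ∷ b≢e ∷ b≢f ∷ []) ∷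
       (Adj⇒≢ cd ∷ c≢e ∷ c≢f ∷ []) ∷ (Adj⇒≢ de ∷ d≢f ∷ []) ∷ (Adj⇒≢ ef ∷ []) ∷ [] ∷ [])
      (ab ∷ bc ∷ cd ∷ de ∷ ef ∷ [-]) fa

  paths₃-diagonal : ∀ i → paths₃ i i ≡ 0ℚ
  paths₃-diagonal i = ∑-zero (λ a → ∑-zero (λ b → 𝟙-no (Path₃? i a b i) λ (ia , ab , bi , _) → no-triangle ia ab bi))

  Path₂⇒shortest₂ : i ≢ j → Path₂ i a j → Shortest i j k → k ≡ 2
  Path₂⇒shortest₂ i≢i _         (nil , _)                        = contradiction refl i≢i
  Path₂⇒shortest₂ _   (ia , aj) (cons ij nil , _)                = ⊥-elim (no-triangle ia aj (Adj-sym ij))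
  Path₂⇒shortest₂ _   _         (cons _ (cons _ nil) , _)        = refl
  Path₂⇒shortest₂ _   (ia , aj) (cons _ (cons _ (cons _ _)) , min) =
    contradiction (min 2 (cons ia (cons aj nil))) λ { (s≤s (s≤s ())) }

  shortest₂⇒unique : Shortest i j 2 → ∃ λ a₀ → Path₂ i a₀ j × ∀ {a} → Path₂ i a j → a ≡ a₀
  shortest₂⇒unique {i} {j} (cons {j = a₀} ia₀ (cons a₀j nil) , min) = a₀ , (ia₀ , a₀j) , unique
    where
    i≢j : i ≢ j
    i≢j i≡j = contradiction (min 0 (subst (λ x → Walk G i x 0) i≡j nil)) λ ()
    unique : ∀ {a} → Path₂ i a j → a ≡ a₀
    unique {a} (ia , aj) with a ≟ᶠ a₀
    ... | yes a≡a₀ = a≡a₀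
    ... | no  a≢a₀ = ⊥-elim (no-square ia aj (Adj-sym a₀j) (Adj-sym ia₀) i≢j a≢a₀)

  Path₃⇒shortest₃ : i ≢ j → Path₃ i a b j → Shortest i j k → k ≡ 3
  Path₃⇒shortest₃ i≢i _ (nil , _) = contradiction refl i≢i
  Path₃⇒shortest₃ _ (ia , ab , bj , b≢i , a≢j) (cons ji nil , _) =
    ⊥-elim (no-square ia ab bj (Adj-sym ji) (≢-sym b≢i) a≢j)
  Path₃⇒shortest₃ {a = a} {b} i≢j (ia , ab , bj , b≢i , a≢j) (cons {j = c} ic (cons cj nil) , _)
    with a ≟ᶠ c | b ≟ᶠ c
  ... | yes refl | _        = ⊥-elim (no-triangle ab bj (Adj-sym cj))
  ... | no _     | yes refl = ⊥-elim (no-triangle ia ab (Adj-sym ic))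
  ... | no a≢c   | no b≢c   = ⊥-elim (no-pentagon ia ab bj (Adj-sym cj) (Adj-sym ic) (≢-sym b≢i) i≢j a≢j a≢c b≢c)
  Path₃⇒shortest₃ _ _ (cons _ (cons _ (cons _ nil)) , _) = refl
  Path₃⇒shortest₃ _ (ia , ab , bj , _) (cons _ (cons _ (cons _ (cons _ _))) , min) =
    contradiction (min 3 (cons ia (cons ab (cons bj nil)))) λ { (s≤s (s≤s (s≤s ()))) }

  shortest₃⇒unique : Shortest i j 3 →
                     ∃₂ λ a₀ b₀ → Path₃ i a₀ b₀ j × ∀ {a b} → Path₃ i a b j → a ≡ a₀ × b ≡ b₀
  shortest₃⇒unique {i} {j} (cons {j = a₀} ia₀ (cons {j = b₀} a₀b₀ (cons b₀j nil)) , min) =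
    a₀ , b₀ , (ia₀ , a₀b₀ , b₀j , b₀≢i , a₀≢j) , unique
    where
    i≢j : i ≢ j
    i≢j i≡j = contradiction (min 0 (subst (λ x → Walk G i x 0) i≡j nil)) λ ()
    i≁j : ¬ Adj G i j
    i≁j ij = contradiction (min 1 (cons ij nil)) λ { (s≤s ()) }
    no-Path₂ : ¬ Path₂ i c j
    no-Path₂ (ic , cj) = contradiction (min 2 (cons ic (cons cj nil))) λ { (s≤s (s≤s ())) }
    b₀≢i : b₀ ≢ i
    b₀≢i b₀≡i = i≁j (subst (λ x → Adj G x j) b₀≡i b₀j)
    a₀≢j : a₀ ≢ j
    a₀≢j a₀≡j = i≁j (subst (Adj G i) a₀≡j ia₀)
    unique : ∀ {a b} → Path₃ i a b j → a ≡ a₀ × b ≡ b₀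
    unique {a} {b} (ia , ab , bj , b≢i , a≢j) with a ≟ᶠ a₀ | b ≟ᶠ b₀
    ... | yes a≡a₀ | yes b≡b₀ = a≡a₀ , b≡b₀
    ... | yes refl | no b≢b₀  = ⊥-elim (no-square ab bj (Adj-sym b₀j) (Adj-sym a₀b₀) a₀≢j b≢b₀)
    ... | no a≢a₀  | yes refl = ⊥-elim (no-square ia ab (Adj-sym a₀b₀) (Adj-sym ia₀) (≢-sym b₀≢i) a≢a₀)
    ... | no a≢a₀  | no b≢b₀  = ⊥-elim (no-hexagon ia ab bj (Adj-sym b₀j) (Adj-sym a₀b₀) (Adj-sym ia₀)
      (≢-sym b≢i) i≢j (≢-sym b₀≢i) a≢j (λ a≡b₀ → no-Path₂ (subst (Adj G i) a≡b₀ ia , b₀j)) a≢a₀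
      b≢b₀ (λ b≡a₀ → no-Path₂ (ia₀ , subst (λ x → Adj G x j) b≡a₀ bj)) (≢-sym a₀≢j))

module Distances {n : ℕ} (G : Graph n) (girth≥7 : GirthAtLeast G 7)
                 (dist : Fin n → Fin n → ℕ) (dist-shortest : IsDistance G dist) where

  open Adjacency G
  open Walks G
  open ShortCycleFree G girth≥7

  Shortest-dist : ∀ {i j k} → dist i j ≡ k → Shortest i j k
  Shortest-dist {i} {j} d≡k = subst (Shortest i j) d≡k (dist-shortest i j)

  A≡𝟙[d≡1] : ∀ i j → A i j ≡ 𝟙 (dist i j ℕ.≟ 1)
  A≡𝟙[d≡1] i j = 𝟙-⇔ (Adj? i j) (dist i j ℕ.≟ 1)
    (λ ij → Adj⇒shortest₁ ij (dist-shortest i j))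
    (shortest₁⇒Adj ∘ Shortest-dist)

  paths₂≡𝟙[d≡2] : ∀ {i j} → i ≢ j → paths₂ i j ≡ 𝟙 (dist i j ℕ.≟ 2)
  paths₂≡𝟙[d≡2] {i} {j} i≢j = ∑𝟙-unique (λ a → Path₂? i a j) (dist i j ℕ.≟ 2)
    (λ p → Path₂⇒shortest₂ i≢j p (dist-shortest i j))
    (shortest₂⇒unique ∘ Shortest-dist)

  paths₃≡𝟙[d≡3] : ∀ {i j} → i ≢ j → paths₃ i j ≡ 𝟙 (dist i j ℕ.≟ 3)
  paths₃≡𝟙[d≡3] {i} {j} i≢j = ∑∑𝟙-unique (λ a b → Path₃? i a b j) (dist i j ℕ.≟ 3)
    (λ p → Path₃⇒shortest₃ i≢j p (dist-shortest i j))
    (shortest₃⇒unique ∘ Shortest-dist)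

  far : Fin n → Fin n → ℚ
  far i j = 𝟙 (4 ℕ.≤? dist i j)

  dist-split : (f : ℕ → ℚ) → ∀ i j → i ≢ j →
    f (dist i j) ≡ f 1 * A i j + f 2 * paths₂ i j + f 3 * paths₃ i j + far i j * f (dist i j)
  dist-split f i j i≢j = begin
    f (dist i j)
      ≡⟨ split-at-4 f (dist i j) (i≢j ∘ shortest₀⇒≡ ∘ Shortest-dist) ⟩
    f 1 * 𝟙 (dist i j ℕ.≟ 1) + f 2 * 𝟙 (dist i j ℕ.≟ 2) + f 3 * 𝟙 (dist i j ℕ.≟ 3) + far i j * f (dist i j)
      ≡⟨ cong (_+ far i j * f (dist i j)) (cong₂ _+_ (cong₂ _+_ (cong (f 1 *_) (A≡𝟙[d≡1] i j))
                                                            (cong (f 2 *_) (paths₂≡𝟙[d≡2] i≢j)))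
                                                 (cong (f 3 *_) (paths₃≡𝟙[d≡3] i≢j))) ⟨
    f 1 * A i j + f 2 * paths₂ i j + f 3 * paths₃ i j + far i j * f (dist i j) ∎
    where open ≡-Reasoning

  pairSum-decomposition : (f : ℕ → ℚ) →
    pairSum dist f ≡ f 1 * (fromℕ 2 * m) + f 2 * (m₁ - fromℕ 2 * m)
                     + f 3 * (fromℕ 2 * m₂ - fromℕ 2 * m₁ + fromℕ 2 * m) + ∑≠ (λ i j → far i j * f (dist i j))
  pairSum-decomposition f = begin
    pairSum dist f
      ≡⟨ pairSum≡∑≠ dist f ⟩
    ∑≠ (λ i j → f (dist i j))
      ≡⟨ ∑≠-cong (dist-split f) ⟩
    ∑≠ (λ i j → f 1 * A i j + f 2 * paths₂ i j + f 3 * paths₃ i j + far i j * f (dist i j))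
      ≡⟨ linearity ⟩
    f 1 * ∑≠ A + f 2 * ∑≠ paths₂ + f 3 * ∑≠ paths₃ + X
      ≡⟨ cong (_+ X) (cong₂ _+_ (cong₂ _+_ (cong (f 1 *_) ∑≠A≡2m) (cong (f 2 *_) ∑≠paths₂≡m₁-2m))
                               (cong (f 3 *_) (∑≠paths₃≡2m₂-2m₁+2m paths₃-diagonal))) ⟩
    f 1 * (fromℕ 2 * m) + f 2 * (m₁ - fromℕ 2 * m) + f 3 * (fromℕ 2 * m₂ - fromℕ 2 * m₁ + fromℕ 2 * m) + X ∎
    where
    open ≡-Reasoning
    Far : Fin n → Fin n → ℚ
    Far i j = far i j * f (dist i j)
    X : ℚ
    X = ∑≠ Far
    linearity : ∑≠ (λ i j → f 1 * A i j + f 2 * paths₂ i j + f 3 * paths₃ i j + Far i j)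
                ≡ f 1 * ∑≠ A + f 2 * ∑≠ paths₂ + f 3 * ∑≠ paths₃ + X
    linearity =
      trans (∑≠-distrib-+ (λ i j → f 1 * A i j + f 2 * paths₂ i j + f 3 * paths₃ i j) Far) (cong (_+ X)
      (trans (∑≠-distrib-+ (λ i j → f 1 * A i j + f 2 * paths₂ i j) (λ i j → f 3 * paths₃ i j)) (cong₂ _+_
        (trans (∑≠-distrib-+ (λ i j → f 1 * A i j) (λ i j → f 2 * paths₂ i j))
               (cong₂ _+_ (∑≠-*ˡ (f 1) A) (∑≠-*ˡ (f 2) paths₂)))
        (∑≠-*ˡ (f 3) paths₃))))

  N R : ℚ
  N = fromℕ n
  R = N * (N - 1ℚ) + m₁ - fromℕ 2 * m - fromℕ 2 * m₂

  far-count : ∑≠ far ≡ R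
  far-count = begin
    ∑≠ far                                           ≡⟨ ∑≠-cong (λ i j _ → *-identityʳ (far i j)) ⟨
    F                                                ≡⟨ isolate c₁ c₂ c₃ F ⟩
    (1ℚ * c₁ + 1ℚ * c₂ + 1ℚ * c₃ + F) - (c₁ + c₂ + c₃) ≡⟨ cong (_- (c₁ + c₂ + c₃)) all-pairs ⟩
    N * (N - 1ℚ) - (c₁ + c₂ + c₃)                    ≡⟨ collect (N * (N - 1ℚ)) m m₁ m₂ ⟩
    R                                                ∎
    where
    open ≡-Reasoning
    c₁ c₂ c₃ F : ℚ
    c₁ = fromℕ 2 * m
    c₂ = m₁ - fromℕ 2 * m
    c₃ = fromℕ 2 * m₂ - fromℕ 2 * m₁ + fromℕ 2 * m
    F  = ∑≠ (λ i j → far i j * 1ℚ)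
    all-pairs : 1ℚ * c₁ + 1ℚ * c₂ + 1ℚ * c₃ + F ≡ N * (N - 1ℚ)
    all-pairs = trans (sym (pairSum-decomposition (λ _ → 1ℚ))) (trans (pairSum≡∑≠ dist (λ _ → 1ℚ)) (∑≠-one {n}))
    isolate : ∀ a b c x → x ≡ (1ℚ * a + 1ℚ * b + 1ℚ * c + x) - (a + b + c)
    isolate = solve-∀ ℚ-ring
    collect : ∀ s x y z → s - (fromℕ 2 * x + (y - fromℕ 2 * x) + (fromℕ 2 * z - fromℕ 2 * y + fromℕ 2 * x))
                          ≡ s + y - fromℕ 2 * x - fromℕ 2 * z
    collect = solve-∀ ℚ-ring

  module _ (α : ℚ) where

    T : ℚ
    T = fromℕ 2 * (α ^ℚ 3) * (m₂ + m) + (α ^ℚ 2) * m₁ * (1ℚ - fromℕ 2 * α) + fromℕ 2 * m * α * (1ℚ - α)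

    GC-decomposition : GC dist α ≡ ∑≠ (λ i j → far i j * α ^ℚ dist i j) + T
    GC-decomposition = begin
      GC dist α
        ≡⟨ pairSum-decomposition (α ^ℚ_) ⟩
      α ^ℚ 1 * (fromℕ 2 * m) + α ^ℚ 2 * (m₁ - fromℕ 2 * m)
        + α ^ℚ 3 * (fromℕ 2 * m₂ - fromℕ 2 * m₁ + fromℕ 2 * m) + X
        ≡⟨ cong (_+ X) (collect α m m₁ m₂) ⟩
      T + X
        ≡⟨ +-comm T X ⟩
      X + T ∎
      where
      open ≡-Reasoning
      X : ℚ
      X = ∑≠ (λ i j → far i j * α ^ℚ dist i j)
      collect : ∀ a x y z →
        (a * 1ℚ) * (fromℕ 2 * x) + (a * (a * 1ℚ)) * (y - fromℕ 2 * x)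
          + (a * (a * (a * 1ℚ))) * (fromℕ 2 * z - fromℕ 2 * y + fromℕ 2 * x)
        ≡ fromℕ 2 * (a * (a * (a * 1ℚ))) * (z + x) + (a * (a * 1ℚ)) * y * (1ℚ - fromℕ 2 * a)
          + fromℕ 2 * x * a * (1ℚ - a)
      collect = solve-∀ ℚ-ring

  module Diameter (d : ℕ) (within-d : ∀ i j → dist i j ℕ.≤ d) where

    scaled-far-count : ∀ c → c * R ≡ ∑≠ (λ i j → c * far i j)
    scaled-far-count c = trans (cong (c *_) (sym far-count)) (sym (∑≠-*ˡ c far))

    GC-bounds : ∀ {α} → 0ℚ ≤ α → α ≤ 1ℚ → α ^ℚ d * R + T α ≤ GC dist α × GC dist α ≤ α ^ℚ 4 * R + T α
    GC-bounds {α} 0≤α α≤1 = lower , upper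
      where
      open ≤-Reasoning
      X : ℚ
      X = ∑≠ (λ i j → far i j * α ^ℚ dist i j)
      lower : α ^ℚ d * R + T α ≤ GC dist α
      lower = begin
        α ^ℚ d * R + T α                      ≡⟨ cong (_+ T α) (scaled-far-count (α ^ℚ d)) ⟩
        ∑≠ (λ i j → α ^ℚ d * far i j) + T α   ≤⟨ +-monoˡ-≤ (T α) (∑≠-mono-≤ (λ i j _ →
                                                   proj₁ (beyond-4-bounds 0≤α α≤1 (within-d i j)))) ⟩
        X + T α                               ≡⟨ GC-decomposition α ⟨
        GC dist α                             ∎
      upper : GC dist α ≤ α ^ℚ 4 * R + T α
      upper = begin
        GC dist α                             ≡⟨ GC-decomposition α ⟩
        X + T α                               ≤⟨ +-monoˡ-≤ (T α) (∑≠-mono-≤ (λ i j _ →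
                                                   proj₂ (beyond-4-bounds 0≤α α≤1 (within-d i j)))) ⟩
        ∑≠ (λ i j → α ^ℚ 4 * far i j) + T α   ≡⟨ cong (_+ T α) (scaled-far-count (α ^ℚ 4)) ⟨
        α ^ℚ 4 * R + T α                      ∎

    GC-exact : ∀ α → d ℕ.≤ 4 → α ^ℚ d * R + T α ≡ GC dist α × GC dist α ≡ α ^ℚ 4 * R + T α
    GC-exact α d≤4 = lower , upper
      where
      open ≡-Reasoning
      X : ℚ
      X = ∑≠ (λ i j → far i j * α ^ℚ dist i j)
      lower : α ^ℚ d * R + T α ≡ GC dist α
      lower = begin
        α ^ℚ d * R + T α                      ≡⟨ cong (_+ T α) (scaled-far-count (α ^ℚ d)) ⟩
        ∑≠ (λ i j → α ^ℚ d * far i j) + T α   ≡⟨ cong (_+ T α) (∑≠-cong (λ i j _ →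
                                                   proj₁ (beyond-4-exact α (within-d i j) d≤4))) ⟩
        X + T α                               ≡⟨ GC-decomposition α ⟨
        GC dist α                             ∎
      upper : GC dist α ≡ α ^ℚ 4 * R + T α
      upper = begin
        GC dist α                             ≡⟨ GC-decomposition α ⟩
        X + T α                               ≡⟨ cong (_+ T α) (∑≠-cong (λ i j _ →
                                                   proj₂ (beyond-4-exact α (within-d i j) d≤4))) ⟩
        ∑≠ (λ i j → α ^ℚ 4 * far i j) + T α   ≡⟨ cong (_+ T α) (scaled-far-count (α ^ℚ 4)) ⟨
        α ^ℚ 4 * R + T α                      ∎

    CL CU : ℚ
    CL = R * (½ ^ℚ d) + (m₂ + fromℕ 3 * m) * (+ 1 / 4)
    CU = (N * (N - 1ℚ) + m₁ + fromℕ 2 * m₂ + fromℕ 10 * m) * (+ 1 / 16)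

    CL≡L½ : CL ≡ ½ ^ℚ d * R + T ½
    CL≡L½ = cong₂ _+_ (*-comm R (½ ^ℚ d)) (at-½ m m₁ m₂)
      where
      at-½ : ∀ x y z → (z + fromℕ 3 * x) * (+ 1 / 4)
             ≡ fromℕ 2 * (½ * (½ * (½ * 1ℚ))) * (z + x) + (½ * (½ * 1ℚ)) * y * (1ℚ - fromℕ 2 * ½)
               + fromℕ 2 * x * ½ * (1ℚ - ½)
      at-½ = solve-∀ ℚ-ring

    U½≡CU : ½ ^ℚ 4 * R + T ½ ≡ CU
    U½≡CU = at-½ (N * (N - 1ℚ)) m m₁ m₂
      where
      at-½ : ∀ s x y z → (½ * (½ * (½ * (½ * 1ℚ)))) * (s + y - fromℕ 2 * x - fromℕ 2 * z)
               + (fromℕ 2 * (½ * (½ * (½ * 1ℚ))) * (z + x) + (½ * (½ * 1ℚ)) * y * (1ℚ - fromℕ 2 * ½)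
               + fromℕ 2 * x * ½ * (1ℚ - ½))
             ≡ (s + y + fromℕ 2 * z + fromℕ 10 * x) * (+ 1 / 16)
      at-½ = solve-∀ ℚ-ring

    closeness-bounds : CL ≤ closeness dist × closeness dist ≤ CU
    closeness-bounds = ≤-trans (≤-reflexive CL≡L½) (proj₁ GC½-bounds) , ≤-trans (proj₂ GC½-bounds) (≤-reflexive U½≡CU)
      where
      GC½-bounds : ½ ^ℚ d * R + T ½ ≤ GC dist ½ × GC dist ½ ≤ ½ ^ℚ 4 * R + T ½
      GC½-bounds = GC-bounds (nonNegative⁻¹ ½) (toWitness {a? = ½ ≤? 1ℚ} _)

    closeness-exact : d ℕ.≤ 4 → CL ≡ closeness dist × closeness dist ≡ CU
    closeness-exact d≤4 = trans CL≡L½ (proj₁ (GC-exact ½ d≤4)) , trans (proj₂ (GC-exact ½ d≤4)) U½≡CU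

girth≥7 : ∀ {n} {G : Graph n} → IsTree G ⊎ (Connected G × GirthAtLeast G 7) → GirthAtLeast G 7
girth≥7 (inj₁ (_ , acyclic)) k cycle = ⊥-elim (acyclic k cycle)
girth≥7 (inj₂ (_ , girth))          = girth

theorem3p5 :
    (n : ℕ) (G : Graph n) (dist : Fin n → Fin n → ℕ) (d : ℕ) (α : ℚ) →
    (IsTree G ⊎ (Connected G × GirthAtLeast G 7)) →
    IsDistance G dist → IsDiameter G dist d →
    0ℚ < α → α < 1ℚ →
    let m  = fromℕ (numEdges G)
        N  = fromℕ n
        m1 = fromℕ (M₁ G)
        m2 = fromℕ (M₂ G)
        R  = N * (N - 1ℚ) + m1 - fromℕ 2 * m - fromℕ 2 * m2
        T  = fromℕ 2 * (α ^ℚ 3) * (m2 + m) + (α ^ℚ 2) * m1 * (1ℚ - fromℕ 2 * α)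
               + fromℕ 2 * m * α * (1ℚ - α)
        L  = (α ^ℚ d) * R + T
        U  = (α ^ℚ 4) * R + T
        CL = R * (½ ^ℚ d) + (m2 + fromℕ 3 * m) * (+ 1 / 4)
        CU = (N * (N - 1ℚ) + m1 + fromℕ 2 * m2 + fromℕ 10 * m) * (+ 1 / 16)
    in (L ≤ GC dist α × GC dist α ≤ U)
       × (CL ≤ closeness dist × closeness dist ≤ CU)
       × (d Data.Nat.≤ 4 → (L ≡ GC dist α × GC dist α ≡ U)
                          × (CL ≡ closeness dist × closeness dist ≡ CU))
theorem3p5 n G dist d α tree-or-girth≥7 dist-shortest (within-d , _) 0<α α<1 =
  GC-bounds (<⇒≤ 0<α) (<⇒≤ α<1) , closeness-bounds , λ d≤4 → GC-exact α d≤4 , closeness-exact d≤4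
  where
  open Distances G (girth≥7 tree-or-girth≥7) dist dist-shortest
  open Diameter d within-d
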